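{- Let $\mathcal{M}$ be the set of Motzkin meanders that contain neither $DD$ nor $HH$ as a contiguous subword, and let $S(u)=\sum_{w\in\mathcal{M}} z^{|w|}u^{\mathrm{level}(w)}$. Put $$W=\sqrt{(1+2z+3z^2+z^3)(1-2z-z^2+z^3)},\qquad r_1=\frac{1-z^2-z^3-W}{2z(1+z)}.$$ Then $$S(u)=\frac{(1+z)r_1}{z(z-u(1+z)r_1)},$$ and for every $j\ge0$ the generating function of the meanders in $\mathcal{M}$ ending at level $j$ is $[u^j]S(u)=\frac{(1+z)^{j+1}r_1^{j+1}}{z^{j+2}}$.
   Context: A Motzkin meander is a finite word $w$ over $\{U,H,D\}$ (heights $+1,0,-1$) all of whose prefixes have nonnegative height sum; $|w|$ is its length and $\mathrm{level}(w)$ its total height sum; the empty word is included; excursions are meanders of level $0$. "Contains $XY$ as a contiguous subword" means two consecutive letters are $X$ then $Y$. Generating functions are formal power series in $z$; $W$ is the formal power series square root with constant term $1$; $[u^j]$ is coefficient extraction. -}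

module Defs where

open import Data.Nat as ℕ using (ℕ; zero; suc; _∸_)
open import Data.Integer as ℤ using (ℤ; +_; -_; -[1+_])
open import Data.List using (List; []; _∷_; map; foldr; upTo; length; filter; concatMap)
open import Data.Bool using (Bool; true; false; _∧_; not)
open import Data.Integer using (_≤ᵇ_)
open import Relation.Binary.PropositionalEquality using (_≡_)
open import Data.Product using (_×_)

data Step : Set where
  U H D : Step

height : Step → ℤ
height U = + 1
height H = + 0
height D = -[1+ 0 ]

level : List Step → ℤ
level [] = + 0
level (s ∷ w) = height s ℤ.+ level w

prefixes : List Step → List (List Step)
prefixes [] = [] ∷ []
prefixes (s ∷ w) = [] ∷ map (s ∷_) (prefixes w)

allB : {A : Set} → (A → Bool) → List A → Bool
allB p = foldr (λ x b → p x ∧ b) true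

isMeander : List Step → Bool
isMeander w = allB (λ v → + 0 ≤ᵇ level v) (prefixes w)

containsPair : (Step → Bool) → (Step → Bool) → List Step → Bool
containsPair X Y [] = false
containsPair X Y (a ∷ []) = false
containsPair X Y (a ∷ b ∷ w) = (X a ∧ Y b) Data.Bool.∨ containsPair X Y (b ∷ w)

isD : Step → Bool
isD D = true
isD _ = false

isH : Step → Bool
isH H = true
isH _ = false

inM : List Step → Bool
inM w = isMeander w ∧ not (containsPair isD isD w) ∧ not (containsPair isH isH w)

words : ℕ → List (List Step)
words zero = [] ∷ []
words (suc n) = concatMap (λ w → (U ∷ w) ∷ (H ∷ w) ∷ (D ∷ w) ∷ []) (words n)

eqℤ : ℤ → ℤ → Bool
eqℤ a b = (a ≤ᵇ b) ∧ (b ≤ᵇ a)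

count : {A : Set} → (A → Bool) → List A → ℕ
count p [] = 0
count p (x ∷ xs) with p x
... | true = suc (count p xs)
... | false = count p xs

m : ℕ → ℕ → ℕ
m n j = count (λ w → inM w ∧ eqℤ (level w) (+ j)) (words n)

FPS : Set
FPS = ℕ → ℤ

sumℤ : List ℤ → ℤ
sumℤ = foldr ℤ._+_ (+ 0)

_≈_ : FPS → FPS → Set
f ≈ g = ∀ n → f n ≡ g n

infix 4 _≈_ _≈₂_
infixl 6 _⊕_ _⊖_ _⊕₂_ _⊖₂_
infixl 7 _⊛_ _⊛₂_
infixr 8 _^ₛ_

_⊕_ : FPS → FPS → FPS
(f ⊕ g) n = f n ℤ.+ g n

_⊖_ : FPS → FPS → FPS
(f ⊖ g) n = f n ℤ.- g n

_⊛_ : FPS → FPS → FPS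
(f ⊛ g) n = sumℤ (map (λ k → f k ℤ.* g (n ∸ k)) (upTo (suc n)))

const : ℤ → FPS
const c zero = c
const c (suc n) = + 0

oneₛ : FPS
oneₛ = const (+ 1)

zₛ : FPS
zₛ 1 = + 1
zₛ _ = + 0

_^ₛ_ : FPS → ℕ → FPS
f ^ₛ zero = oneₛ
f ^ₛ suc k = f ⊛ (f ^ₛ k)

-- polynomial from a coefficient list (constant term first)
poly : List ℤ → FPS
poly [] n = + 0
poly (c ∷ cs) zero = c
poly (c ∷ cs) (suc n) = poly cs n

-- Bivariate formal power series in z and u: f n j = [z^n u^j] f

BPS : Set
BPS = ℕ → ℕ → ℤ

_≈₂_ : BPS → BPS → Set
f ≈₂ g = ∀ n j → f n j ≡ g n j

_⊕₂_ : BPS → BPS → BPS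
(f ⊕₂ g) n j = f n j ℤ.+ g n j

_⊖₂_ : BPS → BPS → BPS
(f ⊖₂ g) n j = f n j ℤ.- g n j

_⊛₂_ : BPS → BPS → BPS
(f ⊛₂ g) n j =
  sumℤ (map (λ a → sumℤ (map (λ b → f a b ℤ.* g (n ∸ a) (j ∸ b)) (upTo (suc j))))
            (upTo (suc n)))

liftz : FPS → BPS
liftz f n zero = f n
liftz f n (suc j) = + 0

uₛ : BPS
uₛ zero 1 = + 1
uₛ _ _ = + 0

S : BPS
S n j = + m n j

Sj : ℕ → FPS
Sj j n = + m n j

radicand : FPS
radicand = poly (+ 1 ∷ + 2 ∷ + 3 ∷ + 1 ∷ []) ⊛ poly (+ 1 ∷ - + 2 ∷ - + 1 ∷ + 1 ∷ [])

onePlusZ : FPS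
onePlusZ = poly (+ 1 ∷ + 1 ∷ [])

numPoly : FPS
numPoly = poly (+ 1 ∷ + 0 ∷ - + 1 ∷ - + 1 ∷ [])

denPoly : FPS
denPoly = poly (+ 0 ∷ + 2 ∷ + 2 ∷ [])

-- Read a word letter by letter, remembering the current height and the last letter: this is
-- the only information needed to decide whether a word stays a meander avoiding DD and HH.
-- Counting words by final height j and last letter gives three families of series with
-- linear recurrences in j, solved by x^j, z ρ x^j and (ρ - 1) x^j where x = z (1+z) ρ and
-- ρ = 1 + z²(1+z) ρ (1 + z ρ). On the other hand the hypotheses on W say that r₁ is the root
-- without constant term of z(1+z) r² - (1 - z² - z³) r + z² = 0, and this root is r₁ = z² ρ.
-- Both claims are then polynomial identities in z, ρ and x^j.
module Submission where

open import Defs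
open import Data.Nat as ℕ using (ℕ; zero; suc; _≡ᵇ_)
import Data.Nat.Properties as ℕP
open import Data.Integer as ℤ using (ℤ; +_; -_; -[1+_]; _≤ᵇ_)
import Data.Integer.Properties as ℤP
open import Data.Bool using (Bool; true; false; _∧_; not)
open import Data.Bool.Properties using (∧-zeroʳ)
open import Data.List using (List; []; _∷_; map; foldr; foldl; _∷ʳ_; upTo; applyUpTo; concatMap)
open import Data.List.Properties using (map-upTo; map-cong; foldl-∷ʳ)
open import Data.Product using (_×_; _,_; proj₁; proj₂)
open import Function using (_∘_)
open import Relation.Binary.PropositionalEquality using (_≡_; refl; sym; trans; cong; cong₂; module ≡-Reasoning)
open import Algebra.Bundles using (CommutativeMonoid; CommutativeRing)
open import Algebra.Structures using (IsCommutativeRing)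
import Algebra.Construct.Pointwise as Pointwise
import Relation.Binary.Reasoning.Setoid

module _ {c ℓ} (M : CommutativeMonoid c ℓ) where
  open CommutativeMonoid M using (Carrier; _∙_; ε; ∙-congˡ; identityʳ; commutativeSemigroup)
    renaming (_≈_ to _≈ᴹ_; sym to symᴹ; trans to transᴹ)
  open import Algebra.Properties.CommutativeSemigroup commutativeSemigroup using (interchange)

  sum-map-∙ : ∀ {A : Set} (f g : A → Carrier) xs →
              foldr _∙_ ε (map (λ x → f x ∙ g x) xs) ≈ᴹ foldr _∙_ ε (map f xs) ∙ foldr _∙_ ε (map g xs)
  sum-map-∙ f g []       = symᴹ (identityʳ ε)
  sum-map-∙ f g (x ∷ xs) = transᴹ (∙-congˡ (sum-map-∙ f g xs)) (interchange (f x) (g x) _ _)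

module PowerSeriesRing where
  open import Data.Integer using (_+_; _*_)
  open import Data.Integer.Tactic.RingSolver using (solve-∀)
  open import Algebra.Properties.CommutativeSemigroup ℤP.+-commutativeSemigroup using (interchange)
  open ≡-Reasoning

  tail : FPS → FPS
  tail f n = f (suc n)

  zeroₛ : FPS
  zeroₛ _ = + 0

  negₛ : FPS → FPS
  negₛ f n = - f n

  scale : ℤ → FPS → FPS
  scale c f n = c * f n

  ⊛-at-zero : ∀ f g → (f ⊛ g) 0 ≡ f 0 * g 0
  ⊛-at-zero f g = ℤP.+-identityʳ (f 0 * g 0)

  ⊛-at-suc : ∀ f g n → (f ⊛ g) (suc n) ≡ f 0 * g (suc n) + (tail f ⊛ g) n
  ⊛-at-suc f g n = begin
    sumℤ (map term (upTo (suc (suc n))))            ≡⟨ cong sumℤ (map-upTo term (suc (suc n))) ⟩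
    sumℤ (applyUpTo term (suc (suc n)))             ≡⟨ cong (_+_ (term 0)) (cong sumℤ (map-upTo (term ∘ suc) (suc n))) ⟨
    term 0 + sumℤ (map (term ∘ suc) (upTo (suc n))) ∎
    where
    term : ℕ → ℤ
    term k = f k * g (suc n ℕ.∸ k)

  ⊛-cong : ∀ {f f′ g g′} → f ≈ f′ → g ≈ g′ → f ⊛ g ≈ f′ ⊛ g′
  ⊛-cong {f} {f′} {g} {g′} f≈f′ g≈g′ zero = begin
    (f ⊛ g) 0     ≡⟨ ⊛-at-zero f g ⟩
    f 0 * g 0     ≡⟨ cong₂ _*_ (f≈f′ 0) (g≈g′ 0) ⟩
    f′ 0 * g′ 0   ≡⟨ ⊛-at-zero f′ g′ ⟨
    (f′ ⊛ g′) 0   ∎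
  ⊛-cong {f} {f′} {g} {g′} f≈f′ g≈g′ (suc n) = begin
    (f ⊛ g) (suc n)
      ≡⟨ ⊛-at-suc f g n ⟩
    f 0 * g (suc n) + (tail f ⊛ g) n
      ≡⟨ cong₂ _+_ (cong₂ _*_ (f≈f′ 0) (g≈g′ (suc n))) (⊛-cong (f≈f′ ∘ suc) g≈g′ n) ⟩
    f′ 0 * g′ (suc n) + (tail f′ ⊛ g′) n
      ≡⟨ ⊛-at-suc f′ g′ n ⟨
    (f′ ⊛ g′) (suc n)
      ∎

  ⊖-cong : ∀ {f f′ g g′} → f ≈ f′ → g ≈ g′ → f ⊖ g ≈ f′ ⊖ g′
  ⊖-cong f≈f′ g≈g′ n = cong₂ ℤ._-_ (f≈f′ n) (g≈g′ n)

  ⊛-congˡ : ∀ f {g g′} → g ≈ g′ → f ⊛ g ≈ f ⊛ g′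
  ⊛-congˡ f = ⊛-cong {f} (λ _ → refl)

  ⊛-congʳ : ∀ g {f f′} → f ≈ f′ → f ⊛ g ≈ f′ ⊛ g
  ⊛-congʳ g f≈f′ = ⊛-cong {g = g} f≈f′ (λ _ → refl)

  ⊛-zeroˡ : ∀ {f} g → f ≈ zeroₛ → f ⊛ g ≈ zeroₛ
  ⊛-zeroˡ {f} g f≈0 zero = trans (⊛-at-zero f g) (cong (ℤ._* g 0) (f≈0 0))
  ⊛-zeroˡ {f} g f≈0 (suc n) = begin
    (f ⊛ g) (suc n)                  ≡⟨ ⊛-at-suc f g n ⟩
    f 0 * g (suc n) + (tail f ⊛ g) n ≡⟨ cong₂ _+_ (cong (ℤ._* g (suc n)) (f≈0 0)) (⊛-zeroˡ g (f≈0 ∘ suc) n) ⟩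
    + 0                              ∎

  ⊛-identityˡ : ∀ f → oneₛ ⊛ f ≈ f
  ⊛-identityˡ f zero = trans (⊛-at-zero oneₛ f) (ℤP.*-identityˡ (f 0))
  ⊛-identityˡ f (suc n) = begin
    (oneₛ ⊛ f) (suc n)                     ≡⟨ ⊛-at-suc oneₛ f n ⟩
    + 1 * f (suc n) + (tail oneₛ ⊛ f) n    ≡⟨ cong₂ _+_ (ℤP.*-identityˡ (f (suc n))) (⊛-zeroˡ f (λ _ → refl) n) ⟩
    f (suc n) + + 0                        ≡⟨ ℤP.+-identityʳ (f (suc n)) ⟩
    f (suc n)                              ∎

  ⊛-distribˡ-⊕ : ∀ f g h → f ⊛ (g ⊕ h) ≈ f ⊛ g ⊕ f ⊛ h
  ⊛-distribˡ-⊕ f g h zero = begin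
    (f ⊛ (g ⊕ h)) 0             ≡⟨ ⊛-at-zero f (g ⊕ h) ⟩
    f 0 * (g 0 + h 0)           ≡⟨ ℤP.*-distribˡ-+ (f 0) (g 0) (h 0) ⟩
    f 0 * g 0 + f 0 * h 0       ≡⟨ cong₂ _+_ (⊛-at-zero f g) (⊛-at-zero f h) ⟨
    (f ⊛ g) 0 + (f ⊛ h) 0       ∎
  ⊛-distribˡ-⊕ f g h (suc n) = begin
    (f ⊛ (g ⊕ h)) (suc n)
      ≡⟨ ⊛-at-suc f (g ⊕ h) n ⟩
    f 0 * (g (suc n) + h (suc n)) + (tail f ⊛ (g ⊕ h)) n
      ≡⟨ cong₂ _+_ (ℤP.*-distribˡ-+ (f 0) (g (suc n)) (h (suc n))) (⊛-distribˡ-⊕ (tail f) g h n) ⟩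
    (f 0 * g (suc n) + f 0 * h (suc n)) + ((tail f ⊛ g) n + (tail f ⊛ h) n)
      ≡⟨ interchange (f 0 * g (suc n)) (f 0 * h (suc n)) ((tail f ⊛ g) n) ((tail f ⊛ h) n) ⟩
    (f 0 * g (suc n) + (tail f ⊛ g) n) + (f 0 * h (suc n) + (tail f ⊛ h) n)
      ≡⟨ cong₂ _+_ (⊛-at-suc f g n) (⊛-at-suc f h n) ⟨
    (f ⊛ g) (suc n) + (f ⊛ h) (suc n)
      ∎

  private
    CommutesAt : ℕ → Set
    CommutesAt n = ∀ f g → (f ⊛ g) n ≡ (g ⊛ f) n

  -- Expanding both sides twice needs commutativity at n and at n - 1.
  ⊛-commutesAt : ∀ n → CommutesAt n × CommutesAt (suc n)
  ⊛-commutesAt zero = at-zero , at-one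
    where
    at-zero : CommutesAt 0
    at-zero f g = begin
      (f ⊛ g) 0 ≡⟨ ⊛-at-zero f g ⟩
      f 0 * g 0 ≡⟨ ℤP.*-comm (f 0) (g 0) ⟩
      g 0 * f 0 ≡⟨ ⊛-at-zero g f ⟨
      (g ⊛ f) 0 ∎
    at-one : CommutesAt 1
    at-one f g = begin
      (f ⊛ g) 1                   ≡⟨ ⊛-at-suc f g 0 ⟩
      f 0 * g 1 + (tail f ⊛ g) 0  ≡⟨ cong (_+_ (f 0 * g 1)) (⊛-at-zero (tail f) g) ⟩
      f 0 * g 1 + f 1 * g 0       ≡⟨ swap (f 0) (g 1) (f 1) (g 0) ⟩
      g 0 * f 1 + g 1 * f 0       ≡⟨ cong (_+_ (g 0 * f 1)) (⊛-at-zero (tail g) f) ⟨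
      g 0 * f 1 + (tail g ⊛ f) 0  ≡⟨ ⊛-at-suc g f 0 ⟨
      (g ⊛ f) 1                   ∎
      where
      swap : ∀ a b c d → a * b + c * d ≡ d * c + b * a
      swap = solve-∀
  ⊛-commutesAt (suc n) = proj₂ ih , at-suc
    where
    ih = ⊛-commutesAt n
    at-suc : CommutesAt (suc (suc n))
    at-suc f g = begin
      (f ⊛ g) k
        ≡⟨ ⊛-at-suc f g (suc n) ⟩
      f 0 * g k + (tail f ⊛ g) (suc n)
        ≡⟨ cong (_+_ (f 0 * g k)) (proj₂ ih (tail f) g) ⟩
      f 0 * g k + (g ⊛ tail f) (suc n)
        ≡⟨ cong (_+_ (f 0 * g k)) (⊛-at-suc g (tail f) n) ⟩
      f 0 * g k + (g 0 * f k + (tail g ⊛ tail f) n)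
        ≡⟨ cong (λ x → f 0 * g k + (g 0 * f k + x)) (proj₁ ih (tail g) (tail f)) ⟩
      f 0 * g k + (g 0 * f k + (tail f ⊛ tail g) n)
        ≡⟨ exchange (f 0 * g k) (g 0 * f k) ((tail f ⊛ tail g) n) ⟩
      g 0 * f k + (f 0 * g k + (tail f ⊛ tail g) n)
        ≡⟨ cong (_+_ (g 0 * f k)) (⊛-at-suc f (tail g) n) ⟨
      g 0 * f k + (f ⊛ tail g) (suc n)
        ≡⟨ cong (_+_ (g 0 * f k)) (proj₂ ih f (tail g)) ⟩
      g 0 * f k + (tail g ⊛ f) (suc n)
        ≡⟨ ⊛-at-suc g f (suc n) ⟨
      (g ⊛ f) k
        ∎
      where
      k : ℕ
      k = suc (suc n)
      exchange : ∀ a b c → a + (b + c) ≡ b + (a + c)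
      exchange = solve-∀

  ⊛-comm : ∀ f g → f ⊛ g ≈ g ⊛ f
  ⊛-comm f g n = proj₁ (⊛-commutesAt n) f g

  ⊛-distribʳ-⊕ : ∀ f g h → (g ⊕ h) ⊛ f ≈ g ⊛ f ⊕ h ⊛ f
  ⊛-distribʳ-⊕ f g h n = begin
    ((g ⊕ h) ⊛ f) n         ≡⟨ ⊛-comm (g ⊕ h) f n ⟩
    (f ⊛ (g ⊕ h)) n         ≡⟨ ⊛-distribˡ-⊕ f g h n ⟩
    (f ⊛ g) n + (f ⊛ h) n   ≡⟨ cong₂ _+_ (⊛-comm f g n) (⊛-comm f h n) ⟩
    (g ⊛ f) n + (h ⊛ f) n   ∎

  scale-⊛ : ∀ c f g → scale c f ⊛ g ≈ scale c (f ⊛ g)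
  scale-⊛ c f g zero = begin
    (scale c f ⊛ g) 0  ≡⟨ ⊛-at-zero (scale c f) g ⟩
    c * f 0 * g 0      ≡⟨ ℤP.*-assoc c (f 0) (g 0) ⟩
    c * (f 0 * g 0)    ≡⟨ cong (c *_) (⊛-at-zero f g) ⟨
    c * (f ⊛ g) 0      ∎
  scale-⊛ c f g (suc n) = begin
    (scale c f ⊛ g) (suc n)                        ≡⟨ ⊛-at-suc (scale c f) g n ⟩
    c * f 0 * g (suc n) + (scale c (tail f) ⊛ g) n ≡⟨ cong₂ _+_ (ℤP.*-assoc c (f 0) (g (suc n))) (scale-⊛ c (tail f) g n) ⟩
    c * (f 0 * g (suc n)) + c * (tail f ⊛ g) n     ≡⟨ ℤP.*-distribˡ-+ c _ _ ⟨
    c * (f 0 * g (suc n) + (tail f ⊛ g) n)         ≡⟨ cong (c *_) (⊛-at-suc f g n) ⟨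
    c * (f ⊛ g) (suc n)                            ∎

  ⊛-assoc : ∀ f g h → (f ⊛ g) ⊛ h ≈ f ⊛ (g ⊛ h)
  ⊛-assoc f g h zero = begin
    ((f ⊛ g) ⊛ h) 0    ≡⟨ ⊛-at-zero (f ⊛ g) h ⟩
    (f ⊛ g) 0 * h 0    ≡⟨ cong (ℤ._* h 0) (⊛-at-zero f g) ⟩
    f 0 * g 0 * h 0    ≡⟨ ℤP.*-assoc (f 0) (g 0) (h 0) ⟩
    f 0 * (g 0 * h 0)  ≡⟨ cong (f 0 *_) (⊛-at-zero g h) ⟨
    f 0 * (g ⊛ h) 0    ≡⟨ ⊛-at-zero f (g ⊛ h) ⟨
    (f ⊛ (g ⊛ h)) 0    ∎
  ⊛-assoc f g h (suc n) = begin
    ((f ⊛ g) ⊛ h) (suc n)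
      ≡⟨ ⊛-at-suc (f ⊛ g) h n ⟩
    (f ⊛ g) 0 * h (suc n) + (tail (f ⊛ g) ⊛ h) n
      ≡⟨ cong₂ _+_ (cong (ℤ._* h (suc n)) (⊛-at-zero f g)) (⊛-congʳ h (⊛-at-suc f g) n) ⟩
    f 0 * g 0 * h (suc n) + ((scale (f 0) (tail g) ⊕ tail f ⊛ g) ⊛ h) n
      ≡⟨ cong (_+_ (f 0 * g 0 * h (suc n))) (⊛-distribʳ-⊕ h (scale (f 0) (tail g)) (tail f ⊛ g) n) ⟩
    f 0 * g 0 * h (suc n) + ((scale (f 0) (tail g) ⊛ h) n + ((tail f ⊛ g) ⊛ h) n)
      ≡⟨ cong (_+_ (f 0 * g 0 * h (suc n))) (cong₂ _+_ (scale-⊛ (f 0) (tail g) h n) (⊛-assoc (tail f) g h n)) ⟩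
    f 0 * g 0 * h (suc n) + (f 0 * (tail g ⊛ h) n + (tail f ⊛ (g ⊛ h)) n)
      ≡⟨ regroup (f 0) (g 0) (h (suc n)) ((tail g ⊛ h) n) ((tail f ⊛ (g ⊛ h)) n) ⟩
    f 0 * (g 0 * h (suc n) + (tail g ⊛ h) n) + (tail f ⊛ (g ⊛ h)) n
      ≡⟨ cong (λ x → f 0 * x + (tail f ⊛ (g ⊛ h)) n) (⊛-at-suc g h n) ⟨
    f 0 * (g ⊛ h) (suc n) + (tail f ⊛ (g ⊛ h)) n
      ≡⟨ ⊛-at-suc f (g ⊛ h) n ⟨
    (f ⊛ (g ⊛ h)) (suc n)
      ∎
    where
    regroup : ∀ a b c d e → a * b * c + (a * d + e) ≡ a * (b * c + d) + e
    regroup = solve-∀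

  ⊛-zeroʳ : ∀ f {g} → g ≈ zeroₛ → f ⊛ g ≈ zeroₛ
  ⊛-zeroʳ f {g} g≈0 n = trans (⊛-comm f g n) (⊛-zeroˡ f g≈0 n)

  ⊛-identityʳ : ∀ f → f ⊛ oneₛ ≈ f
  ⊛-identityʳ f n = trans (⊛-comm f oneₛ n) (⊛-identityˡ f n)

  isCommutativeRing : IsCommutativeRing _≈_ _⊕_ _⊛_ negₛ zeroₛ oneₛ
  isCommutativeRing = record
    { isRing = record
      { +-isAbelianGroup = Pointwise.isAbelianGroup ℕ ℤP.+-0-isAbelianGroup
      ; *-cong           = ⊛-cong
      ; *-assoc          = ⊛-assoc
      ; *-identity       = ⊛-identityˡ , ⊛-identityʳ
      ; distrib          = ⊛-distribˡ-⊕ , ⊛-distribʳ-⊕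
      }
    ; *-comm = ⊛-comm
    }

  commutativeRing : CommutativeRing _ _
  commutativeRing = record { isCommutativeRing = isCommutativeRing }

  const-⊛ : ∀ c f → const c ⊛ f ≈ scale c f
  const-⊛ c f zero = ⊛-at-zero (const c) f
  const-⊛ c f (suc n) = begin
    (const c ⊛ f) (suc n)         ≡⟨ ⊛-at-suc (const c) f n ⟩
    c * f (suc n) + (zeroₛ ⊛ f) n ≡⟨ cong (_+_ (c * f (suc n))) (⊛-zeroˡ f (λ _ → refl) n) ⟩
    c * f (suc n) + + 0           ≡⟨ ℤP.+-identityʳ _ ⟩
    c * f (suc n)                 ∎

  const-homo-* : ∀ a b → const (a * b) ≈ const a ⊛ const b
  const-homo-* a b n = trans (scaled n) (sym (const-⊛ a (const b) n))
    where
    scaled : const (a * b) ≈ scale a (const b)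
    scaled zero = refl
    scaled (suc n) = sym (ℤP.*-zeroʳ a)

open PowerSeriesRing
open CommutativeRing commutativeRing using (+-cong)
  renaming (refl to ≈-refl; sym to ≈-sym; trans to ≈-trans)
module ≈-Reasoning = Relation.Binary.Reasoning.Setoid (CommutativeRing.setoid commutativeRing)

module Solver where
  open import Algebra.Solver.Ring.AlmostCommutativeRing
    using (AlmostCommutativeRing; fromCommutativeRing; _-Raw-AlmostCommutative⟶_)
  open import Data.Maybe using (Maybe; just; nothing)
  open import Relation.Nullary using (yes; no)

  const-homo : ℤ.+-*-rawRing -Raw-AlmostCommutative⟶ fromCommutativeRing commutativeRing
  const-homo = record
    { ⟦_⟧    = const
    ; +-homo = λ a b → λ { zero → refl ; (suc n) → refl }
    ; *-homo = const-homo-*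
    ; -‿homo = λ a → λ { zero → refl ; (suc n) → refl }
    ; 0-homo = λ { zero → refl ; (suc n) → refl }
    ; 1-homo = λ { zero → refl ; (suc n) → refl }
    }

  const-≟ : ∀ a b → Maybe (const a ≈ const b)
  const-≟ a b with a ℤP.≟ b
  ... | yes a≡b = just (λ n → cong (λ c → const c n) a≡b)
  ... | no _    = nothing

  open import Algebra.Solver.Ring ℤ.+-*-rawRing (fromCommutativeRing commutativeRing) const-homo const-≟ public

module SeriesInZ where
  open import Data.Integer using (_+_; _*_)

  zₛ⊛-at-zero : ∀ f → (zₛ ⊛ f) 0 ≡ + 0
  zₛ⊛-at-zero f = trans (⊛-at-zero zₛ f) (ℤP.*-zeroˡ (f 0))

  zₛ⊛-at-suc : ∀ f n → (zₛ ⊛ f) (suc n) ≡ f n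
  zₛ⊛-at-suc f n = begin
    (zₛ ⊛ f) (suc n)                    ≡⟨ ⊛-at-suc zₛ f n ⟩
    + 0 * f (suc n) + (tail zₛ ⊛ f) n   ≡⟨ ℤP.+-identityˡ _ ⟩
    (tail zₛ ⊛ f) n                     ≡⟨ ⊛-congʳ f tail-zₛ n ⟩
    (oneₛ ⊛ f) n                        ≡⟨ ⊛-identityˡ f n ⟩
    f n                                 ∎
    where
    open ≡-Reasoning
    tail-zₛ : tail zₛ ≈ oneₛ
    tail-zₛ zero = refl
    tail-zₛ (suc n) = refl

  zₛ⊛-injective : ∀ {f g} → zₛ ⊛ f ≈ zₛ ⊛ g → f ≈ g
  zₛ⊛-injective {f} {g} zf≈zg n = trans (sym (zₛ⊛-at-suc f n)) (trans (zf≈zg (suc n)) (zₛ⊛-at-suc g n))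

  zₛ⊛-cancel : ∀ {f} → zₛ ⊛ f ≈ zeroₛ → f ≈ zeroₛ
  zₛ⊛-cancel {f} zf≈0 n = trans (sym (zₛ⊛-at-suc f n)) (zf≈0 (suc n))

  const-⊛-cancel : ∀ c .{{_ : ℤ.NonZero c}} {f} → const c ⊛ f ≈ zeroₛ → f ≈ zeroₛ
  const-⊛-cancel c {f} cf≈0 n = ℤP.*-cancelˡ-≡ c (f n) (+ 0) (trans (sym (const-⊛ c f n)) (trans (cf≈0 n) (sym (ℤP.*-zeroʳ c))))

  1+zₛ⊛-cancel : ∀ {f} → (oneₛ ⊕ zₛ) ⊛ f ≈ zeroₛ → f ≈ zeroₛ
  1+zₛ⊛-cancel {f} 1+z·f≈0 = f≈0
    where
    coeff : ∀ n → ((oneₛ ⊕ zₛ) ⊛ f) n ≡ f n + (zₛ ⊛ f) n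
    coeff n = trans (⊛-distribʳ-⊕ f oneₛ zₛ n) (cong (ℤ._+ (zₛ ⊛ f) n) (⊛-identityˡ f n))
    f≈0 : f ≈ zeroₛ
    f≈0 zero = begin
      f 0               ≡⟨ ℤP.+-identityʳ (f 0) ⟨
      f 0 + + 0         ≡⟨ cong (_+_ (f 0)) (zₛ⊛-at-zero f) ⟨
      f 0 + (zₛ ⊛ f) 0  ≡⟨ trans (sym (coeff 0)) (1+z·f≈0 0) ⟩
      + 0               ∎
      where open ≡-Reasoning
    f≈0 (suc n) = begin
      f (suc n)                     ≡⟨ ℤP.+-identityʳ (f (suc n)) ⟨
      f (suc n) + + 0               ≡⟨ cong (_+_ (f (suc n))) (trans (zₛ⊛-at-suc f n) (f≈0 n)) ⟨
      f (suc n) + (zₛ ⊛ f) (suc n)  ≡⟨ trans (sym (coeff (suc n))) (1+z·f≈0 (suc n)) ⟩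
      + 0                           ∎
      where open ≡-Reasoning

  zₛ⊛-factor-zero : ∀ {f} g → f ≈ zₛ ⊛ g → f 0 ≡ + 0
  zₛ⊛-factor-zero g f≈zg = trans (f≈zg 0) (zₛ⊛-at-zero g)

  zₛ⊛-factor-suc : ∀ {f} g → f ≈ zₛ ⊛ g → ∀ n → f (suc n) ≡ g n
  zₛ⊛-factor-suc g f≈zg n = trans (f≈zg (suc n)) (zₛ⊛-at-suc g n)

  ^ₛ-cong : ∀ {f g} k → f ≈ g → f ^ₛ k ≈ g ^ₛ k
  ^ₛ-cong zero    f≈g = ≈-refl {oneₛ}
  ^ₛ-cong (suc k) f≈g = ⊛-cong f≈g (^ₛ-cong k f≈g)

  onePlusZ≈ : onePlusZ ≈ oneₛ ⊕ zₛ
  onePlusZ≈ zero          = refl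
  onePlusZ≈ (suc zero)    = refl
  onePlusZ≈ (suc (suc n)) = refl

  horner : List ℤ → FPS → FPS
  horner [] x = const (+ 0)
  horner (c ∷ cs) x = const c ⊕ x ⊛ horner cs x

  poly≈horner : ∀ cs → poly cs ≈ horner cs zₛ
  poly≈horner [] zero = refl
  poly≈horner [] (suc n) = refl
  poly≈horner (c ∷ cs) = ≈-trans poly-∷ (+-cong (≈-refl {const c}) (⊛-congˡ zₛ (poly≈horner cs)))
    where
    poly-∷ : poly (c ∷ cs) ≈ const c ⊕ zₛ ⊛ poly cs
    poly-∷ zero = sym (trans (cong (_+_ c) (zₛ⊛-at-zero (poly cs))) (ℤP.+-identityʳ c))
    poly-∷ (suc n) = sym (trans (ℤP.+-identityˡ _) (zₛ⊛-at-suc (poly cs) n))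

open SeriesInZ

module KernelEquation where
  open Solver using (solve; Polynomial; con; _:+_; _:*_; _:-_; _:=_)
  open ≈-Reasoning

  :horner : ∀ {k} → List ℤ → Polynomial k → Polynomial k
  :horner [] x = con (+ 0)
  :horner (c ∷ cs) x = con c :+ x :* :horner cs x

  numCoeffs denCoeffs radicandCoeffs₁ radicandCoeffs₂ : List ℤ
  numCoeffs = + 1 ∷ + 0 ∷ - + 1 ∷ - + 1 ∷ []
  denCoeffs = + 0 ∷ + 2 ∷ + 2 ∷ []
  radicandCoeffs₁ = + 1 ∷ + 2 ∷ + 3 ∷ + 1 ∷ []
  radicandCoeffs₂ = + 1 ∷ - + 2 ∷ - + 1 ∷ + 1 ∷ []

  kernelMap : FPS → FPS
  kernelMap r = zₛ ⊕ zₛ ⊛ (oneₛ ⊕ zₛ) ⊛ r ⊕ (oneₛ ⊕ zₛ) ⊛ r ⊛ r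

  -- Completing the square: the discriminant of the quadratic equation for r is the radicand.
  completed-square : ∀ z r →
    const (+ 4) ⊛ (z ⊛ ((oneₛ ⊕ z) ⊛ (z ⊛ (z ⊕ z ⊛ (oneₛ ⊕ z) ⊛ r ⊕ (oneₛ ⊕ z) ⊛ r ⊛ r) ⊖ r)))
      ≈ (horner numCoeffs z ⊖ horner denCoeffs z ⊛ r) ⊛ (horner numCoeffs z ⊖ horner denCoeffs z ⊛ r)
        ⊖ horner radicandCoeffs₁ z ⊛ horner radicandCoeffs₂ z
  completed-square = solve 2 (λ z r →
    con (+ 4) :* (z :* ((con (+ 1) :+ z) :* (z :* (z :+ z :* (con (+ 1) :+ z) :* r :+ (con (+ 1) :+ z) :* r :* r) :- r)))
      := (:horner numCoeffs z :- :horner denCoeffs z :* r) :* (:horner numCoeffs z :- :horner denCoeffs z :* r)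
         :- :horner radicandCoeffs₁ z :* :horner radicandCoeffs₂ z) ≈-refl

  kernel-fixpoint : ∀ {W r} → W ⊛ W ≈ radicand → denPoly ⊛ r ≈ numPoly ⊖ W → r ≈ zₛ ⊛ kernelMap r
  kernel-fixpoint {W} {r} W²≈radicand den·r≈num-W n =
    sym (ℤP.i-j≡0⇒i≡j ((zₛ ⊛ kernelMap r) n) (r n) (difference≈0 n))
    where
    num den rad₁ rad₂ : FPS
    num = horner numCoeffs zₛ
    den = horner denCoeffs zₛ
    rad₁ = horner radicandCoeffs₁ zₛ
    rad₂ = horner radicandCoeffs₂ zₛ
    num-den·r≈W : num ⊖ den ⊛ r ≈ W
    num-den·r≈W = begin
      num ⊖ den ⊛ r            ≈⟨ ⊖-cong (≈-sym (poly≈horner numCoeffs)) (⊛-congʳ r (≈-sym (poly≈horner denCoeffs))) ⟩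
      numPoly ⊖ denPoly ⊛ r    ≈⟨ ⊖-cong (≈-refl {numPoly}) den·r≈num-W ⟩
      numPoly ⊖ (numPoly ⊖ W)  ≈⟨ solve 2 (λ P W → P :- (P :- W) := W) ≈-refl numPoly W ⟩
      W                        ∎
    scaled-difference≈0 : const (+ 4) ⊛ (zₛ ⊛ ((oneₛ ⊕ zₛ) ⊛ (zₛ ⊛ kernelMap r ⊖ r))) ≈ zeroₛ
    scaled-difference≈0 = begin
      const (+ 4) ⊛ (zₛ ⊛ ((oneₛ ⊕ zₛ) ⊛ (zₛ ⊛ kernelMap r ⊖ r)))
        ≈⟨ completed-square zₛ r ⟩
      (num ⊖ den ⊛ r) ⊛ (num ⊖ den ⊛ r) ⊖ rad₁ ⊛ rad₂
        ≈⟨ ⊖-cong (⊛-cong num-den·r≈W num-den·r≈W) ≈-refl ⟩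
      W ⊛ W ⊖ rad₁ ⊛ rad₂
        ≈⟨ ⊖-cong W²≈radicand ≈-refl ⟩
      radicand ⊖ rad₁ ⊛ rad₂
        ≈⟨ ⊖-cong (⊛-cong (poly≈horner radicandCoeffs₁) (poly≈horner radicandCoeffs₂)) ≈-refl ⟩
      rad₁ ⊛ rad₂ ⊖ rad₁ ⊛ rad₂
        ≈⟨ (λ n → ℤP.+-inverseʳ ((rad₁ ⊛ rad₂) n)) ⟩
      zeroₛ
        ∎
    difference≈0 : zₛ ⊛ kernelMap r ⊖ r ≈ zeroₛ
    difference≈0 = 1+zₛ⊛-cancel (zₛ⊛-cancel (const-⊛-cancel (+ 4) scaled-difference≈0))

  kernelMap-cong : ∀ {r r′} → r ≈ r′ → kernelMap r ≈ kernelMap r′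
  kernelMap-cong r≈r′ =
    +-cong (+-cong (≈-refl {zₛ}) (⊛-congˡ (zₛ ⊛ (oneₛ ⊕ zₛ)) r≈r′)) (⊛-cong (⊛-congˡ (oneₛ ⊕ zₛ) r≈r′) r≈r′)

  record Factorisation (r : FPS) : Set where
    field
      ρ        : FPS
      r≈z²ρ    : r ≈ zₛ ⊛ (zₛ ⊛ ρ)
      ρ-fixed  : ρ ≈ oneₛ ⊕ zₛ ⊛ zₛ ⊛ (oneₛ ⊕ zₛ) ⊛ ρ ⊛ (oneₛ ⊕ zₛ ⊛ ρ)

  factorise : ∀ {r} → r ≈ zₛ ⊛ kernelMap r → Factorisation r
  factorise {r} r-fixed = record { ρ = ρ ; r≈z²ρ = r≈z²ρ ; ρ-fixed = ρ-fixed }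
    where
    t ρ : FPS
    t = kernelMap r
    ρ = oneₛ ⊕ zₛ ⊛ (oneₛ ⊕ zₛ) ⊛ t ⊛ (oneₛ ⊕ t)
    t≈zρ : t ≈ zₛ ⊛ ρ
    t≈zρ = begin
      kernelMap r
        ≈⟨ kernelMap-cong r-fixed ⟩
      kernelMap (zₛ ⊛ t)
        ≈⟨ solve 2 (λ z t → z :+ z :* (con (+ 1) :+ z) :* (z :* t) :+ (con (+ 1) :+ z) :* (z :* t) :* (z :* t)
                             := z :* (con (+ 1) :+ z :* (con (+ 1) :+ z) :* t :* (con (+ 1) :+ t)))
                    ≈-refl zₛ t ⟩
      zₛ ⊛ ρ
        ∎
    r≈z²ρ : r ≈ zₛ ⊛ (zₛ ⊛ ρ)
    r≈z²ρ = ≈-trans r-fixed (⊛-congˡ zₛ t≈zρ)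
    K : FPS
    K = oneₛ ⊕ zₛ ⊛ zₛ ⊛ (oneₛ ⊕ zₛ) ⊛ ρ ⊛ (oneₛ ⊕ zₛ ⊛ ρ)
    ρ-fixed : ρ ≈ K
    ρ-fixed = zₛ⊛-injective {ρ} {K} (zₛ⊛-injective (begin
      zₛ ⊛ (zₛ ⊛ ρ)
        ≈⟨ ≈-sym r≈z²ρ ⟩
      r
        ≈⟨ r-fixed ⟩
      zₛ ⊛ kernelMap r
        ≈⟨ ⊛-congˡ zₛ (kernelMap-cong r≈z²ρ) ⟩
      zₛ ⊛ kernelMap (zₛ ⊛ (zₛ ⊛ ρ))
        ≈⟨ solve 2 (λ z ρ → z :* (z :+ z :* (con (+ 1) :+ z) :* (z :* (z :* ρ))
                                   :+ (con (+ 1) :+ z) :* (z :* (z :* ρ)) :* (z :* (z :* ρ)))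
                             := z :* (z :* (con (+ 1) :+ z :* z :* (con (+ 1) :+ z) :* ρ :* (con (+ 1) :+ z :* ρ))))
                    ≈-refl zₛ ρ ⟩
      zₛ ⊛ (zₛ ⊛ K)
        ∎))

open KernelEquation

module Automaton where
  open import Data.Nat using (_+_)
  open ℕP using (+-identityʳ)

  -- alive h l: current height h and last letter l. The empty prefix is encoded by the last
  -- letter U, which forbids no successor.
  data State : Set where
    dead  : State
    alive : ℕ → Step → State

  start : State
  start = alive 0 U

  step : State → Step → State
  step dead              _ = dead
  step (alive h _)       U = alive (suc h) U
  step (alive h H)       H = dead
  step (alive h _)       H = alive h H
  step (alive zero _)    D = dead
  step (alive (suc h) D) D = dead
  step (alive (suc h) _) D = alive h D

  run : State → List Step → State
  run = foldl step

  endsAt : ℕ → State → Bool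
  endsAt j dead        = false
  endsAt j (alive h _) = h ≡ᵇ j

  allB-map : ∀ {A B : Set} (p : B → Bool) (f : A → B) xs → allB p (map f xs) ≡ allB (p ∘ f) xs
  allB-map p f [] = refl
  allB-map p f (x ∷ xs) = cong (p (f x) ∧_) (allB-map p f xs)

  allB-cong : ∀ {A : Set} {p q : A → Bool} → (∀ x → p x ≡ q x) → ∀ xs → allB p xs ≡ allB q xs
  allB-cong p≗q [] = refl
  allB-cong p≗q (x ∷ xs) = cong₂ _∧_ (p≗q x) (allB-cong p≗q xs)

  meanderFrom : ℤ → List Step → Bool
  meanderFrom a w = allB (λ v → + 0 ≤ᵇ a ℤ.+ level v) (prefixes w)

  meanderFrom-∷ : ∀ h t w → meanderFrom (+ h) (t ∷ w) ≡ meanderFrom (+ h ℤ.+ height t) w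
  meanderFrom-∷ h t w = trans (allB-map _ (t ∷_) (prefixes w))
    (allB-cong (λ v → cong (+ 0 ≤ᵇ_) (sym (ℤP.+-assoc (+ h) (height t) (level v)))) (prefixes w))

  meanderFrom-negative : ∀ n w → meanderFrom -[1+ n ] w ≡ false
  meanderFrom-negative n []      = refl
  meanderFrom-negative n (_ ∷ _) = refl

  forbidden : Step → Step → Bool
  forbidden l U = false
  forbidden l H = isH l
  forbidden l D = isD l

  avoids : Step → List Step → Bool
  avoids l w = not (containsPair isD isD (l ∷ w)) ∧ not (containsPair isH isH (l ∷ w))

  avoids-∷ : ∀ l t w → avoids l (t ∷ w) ≡ not (forbidden l t) ∧ avoids t w
  avoids-∷ U U w = refl
  avoids-∷ U H w = refl
  avoids-∷ U D w = refl
  avoids-∷ H U w = refl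
  avoids-∷ H H w = ∧-zeroʳ _
  avoids-∷ H D w = refl
  avoids-∷ D U w = refl
  avoids-∷ D H w = refl
  avoids-∷ D D w = refl

  accepts : ℕ → Step → ℕ → List Step → Bool
  accepts h l j w = (meanderFrom (+ h) w ∧ avoids l w) ∧ eqℤ (+ h ℤ.+ level w) (+ j)

  acceptsFrom : State → ℕ → List Step → Bool
  acceptsFrom dead        j w = false
  acceptsFrom (alive h l) j w = accepts h l j w

  accepts-continue : ∀ {h h′} l t j w → + h ℤ.+ height t ≡ + h′ → forbidden l t ≡ false →
                     accepts h l j (t ∷ w) ≡ accepts h′ t j w
  accepts-continue {h} l t j w h+t≡h′ allowed = cong₂ _∧_
    (cong₂ _∧_ (trans (meanderFrom-∷ h t w) (cong (λ a → meanderFrom a w) h+t≡h′))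
               (trans (avoids-∷ l t w) (cong (λ b → not b ∧ avoids t w) allowed)))
    (cong (λ a → eqℤ a (+ j)) (trans (sym (ℤP.+-assoc (+ h) (height t) (level w))) (cong (ℤ._+ level w) h+t≡h′)))

  accepts-forbidden : ∀ h l t j w → forbidden l t ≡ true → accepts h l j (t ∷ w) ≡ false
  accepts-forbidden h l t j w forbidden≡true = cong (_∧ eqℤ (+ h ℤ.+ level (t ∷ w)) (+ j))
    (trans (cong (meanderFrom (+ h) (t ∷ w) ∧_) (trans (avoids-∷ l t w) (cong (λ b → not b ∧ avoids t w) forbidden≡true)))
           (∧-zeroʳ _))

  accepts-below : ∀ l j w → accepts 0 l j (D ∷ w) ≡ false
  accepts-below l j w = cong (λ b → (b ∧ avoids l (D ∷ w)) ∧ eqℤ (+ 0 ℤ.+ level (D ∷ w)) (+ j))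
    (trans (meanderFrom-∷ 0 D w) (meanderFrom-negative 0 w))

  accepts-∷ : ∀ h l t j w → accepts h l j (t ∷ w) ≡ acceptsFrom (step (alive h l) t) j w
  accepts-∷ h       l U j w = accepts-continue l U j w (cong +_ (ℕP.+-comm h 1)) refl
  accepts-∷ h       U H j w = accepts-continue U H j w (cong +_ (+-identityʳ h)) refl
  accepts-∷ h       D H j w = accepts-continue D H j w (cong +_ (+-identityʳ h)) refl
  accepts-∷ h       H H j w = accepts-forbidden h H H j w refl
  accepts-∷ zero    l D j w = accepts-below l j w
  accepts-∷ (suc h) U D j w = accepts-continue U D j w refl refl
  accepts-∷ (suc h) H D j w = accepts-continue H D j w refl refl
  accepts-∷ (suc h) D D j w = accepts-forbidden (suc h) D D j w refl

  eqℤ-+ : ∀ m n → eqℤ (+ m) (+ n) ≡ (m ≡ᵇ n)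
  eqℤ-+ zero    zero    = refl
  eqℤ-+ zero    (suc n) = refl
  eqℤ-+ (suc m) zero    = refl
  eqℤ-+ (suc m) (suc n) = trans (cong₂ _∧_ (≤ᵇ-suc m n) (≤ᵇ-suc n m)) (eqℤ-+ m n)
    where
    ≤ᵇ-suc : ∀ a b → (suc a ℕ.≤ᵇ suc b) ≡ (a ℕ.≤ᵇ b)
    ≤ᵇ-suc zero    b = refl
    ≤ᵇ-suc (suc a) b = refl

  run-dead : ∀ w → run dead w ≡ dead
  run-dead []      = refl
  run-dead (_ ∷ w) = run-dead w

  acceptsFrom-run : ∀ s j w → acceptsFrom s j w ≡ endsAt j (run s w)
  acceptsFrom-run dead        j w       = cong (endsAt j) (sym (run-dead w))
  acceptsFrom-run (alive h l) j []      = trans (cong (λ a → eqℤ a (+ j)) (cong +_ (+-identityʳ h))) (eqℤ-+ h j)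
  acceptsFrom-run (alive h l) j (t ∷ w) = trans (accepts-∷ h l t j w) (acceptsFrom-run (step (alive h l) t) j w)

  avoids-U : ∀ w → avoids U w ≡ not (containsPair isD isD w) ∧ not (containsPair isH isH w)
  avoids-U []      = refl
  avoids-U (_ ∷ _) = refl

  inM-endsAt : ∀ j w → inM w ∧ eqℤ (level w) (+ j) ≡ endsAt j (run start w)
  inM-endsAt j w =
    trans (cong₂ _∧_ (cong₂ _∧_ meander (sym (avoids-U w))) (cong (λ a → eqℤ a (+ j)) (sym (ℤP.+-identityˡ (level w)))))
          (acceptsFrom-run start j w)
    where
    meander : isMeander w ≡ meanderFrom (+ 0) w
    meander = allB-cong (λ v → cong (+ 0 ≤ᵇ_) (sym (ℤP.+-identityˡ (level v)))) (prefixes w)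

  indicator : Bool → ℕ
  indicator true  = 1
  indicator false = 0

  at : ℕ → Step → State → ℕ
  at j U (alive h U) = indicator (h ≡ᵇ j)
  at j H (alive h H) = indicator (h ≡ᵇ j)
  at j D (alive h D) = indicator (h ≡ᵇ j)
  at j _ _           = 0

  Σsteps : (Step → ℕ) → ℕ
  Σsteps f = f U + f H + f D

  inflow-U-zero : ∀ s → Σsteps (λ t → at 0 U (step s t)) ≡ 0
  inflow-U-zero dead = refl
  inflow-U-zero (alive zero U) = refl
  inflow-U-zero (alive zero H) = refl
  inflow-U-zero (alive zero D) = refl
  inflow-U-zero (alive (suc h) U) = refl
  inflow-U-zero (alive (suc h) H) = refl
  inflow-U-zero (alive (suc h) D) = refl

  inflow-U-suc : ∀ j s → Σsteps (λ t → at (suc j) U (step s t)) ≡ at j U s + at j H s + at j D s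
  inflow-U-suc j dead = refl
  inflow-U-suc j (alive zero U) = refl
  inflow-U-suc j (alive zero H) = +-identityʳ _
  inflow-U-suc j (alive zero D) = trans (+-identityʳ _) (+-identityʳ _)
  inflow-U-suc j (alive (suc h) U) = refl
  inflow-U-suc j (alive (suc h) H) = +-identityʳ _
  inflow-U-suc j (alive (suc h) D) = trans (+-identityʳ _) (+-identityʳ _)

  inflow-H : ∀ j s → Σsteps (λ t → at j H (step s t)) ≡ at j U s + at j D s
  inflow-H j dead = refl
  inflow-H j (alive zero U) = refl
  inflow-H j (alive zero H) = refl
  inflow-H j (alive zero D) = +-identityʳ _
  inflow-H j (alive (suc h) U) = refl
  inflow-H j (alive (suc h) H) = refl
  inflow-H j (alive (suc h) D) = +-identityʳ _

  inflow-D : ∀ j s → Σsteps (λ t → at j D (step s t)) ≡ at (suc j) U s + at (suc j) H s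
  inflow-D j dead = refl
  inflow-D j (alive zero U) = refl
  inflow-D j (alive zero H) = refl
  inflow-D j (alive zero D) = refl
  inflow-D j (alive (suc h) U) = sym (+-identityʳ _)
  inflow-D j (alive (suc h) H) = refl
  inflow-D j (alive (suc h) D) = refl

open Automaton

module Counting where
  open import Data.Nat using (_+_)
  open import Data.Nat.ListAction using (sum)
  open import Data.Nat.Tactic.RingSolver using (solve-∀)
  open ℕP using (+-identityʳ)
  open ≡-Reasoning

  total : (List Step → ℕ) → ℕ → ℕ
  total f n = sum (map f (words n))

  total-cong : ∀ {f g} → (∀ w → f w ≡ g w) → ∀ n → total f n ≡ total g n
  total-cong f≗g n = cong sum (map-cong f≗g (words n))

  total-+ : ∀ f g n → total (λ w → f w + g w) n ≡ total f n + total g n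
  total-+ f g n = sum-map-∙ ℕP.+-0-commutativeMonoid f g (words n)

  total-zero : ∀ n → total (λ _ → 0) n ≡ 0
  total-zero n = go (words n)
    where
    go : ∀ ws → sum (map (λ _ → 0) ws) ≡ 0
    go []       = refl
    go (_ ∷ ws) = go ws

  Σsteps-cong : ∀ {f g} → (∀ t → f t ≡ g t) → Σsteps f ≡ Σsteps g
  Σsteps-cong f≗g = cong₂ _+_ (cong₂ _+_ (f≗g U) (f≗g H)) (f≗g D)

  Σsteps-comm : ∀ (g : Step → Step → ℕ) → Σsteps (λ s → Σsteps (g s)) ≡ Σsteps (λ t → Σsteps (λ s → g s t))
  Σsteps-comm g = transpose (g U U) (g U H) (g U D) (g H U) (g H H) (g H D) (g D U) (g D H) (g D D)
    where
    transpose : ∀ a b c d e f g h i → (a + b + c) + (d + e + f) + (g + h + i) ≡ (a + d + g) + (b + e + h) + (c + f + i)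
    transpose = solve-∀

  total-by-first : ∀ f n → total f (suc n) ≡ total (λ w → Σsteps (λ t → f (t ∷ w))) n
  total-by-first f n = go (words n)
    where
    regroup : ∀ a b c r → a + (b + (c + r)) ≡ a + b + c + r
    regroup = solve-∀
    go : ∀ ws → sum (map f (concatMap (λ w → (U ∷ w) ∷ (H ∷ w) ∷ (D ∷ w) ∷ []) ws))
                ≡ sum (map (λ w → Σsteps (λ t → f (t ∷ w))) ws)
    go []       = refl
    go (w ∷ ws) = trans (regroup (f (U ∷ w)) (f (H ∷ w)) (f (D ∷ w)) _) (cong (_+_ (Σsteps (λ t → f (t ∷ w)))) (go ws))

  total-by-last : ∀ f n → total f (suc n) ≡ total (λ w → Σsteps (λ t → f (w ∷ʳ t))) n
  total-by-last f zero = total-by-first f zero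
  total-by-last f (suc n) = begin
    total f (suc (suc n))
      ≡⟨ total-by-first f (suc n) ⟩
    total (λ w → Σsteps (λ t → f (t ∷ w))) (suc n)
      ≡⟨ total-by-last _ n ⟩
    total (λ w → Σsteps (λ s → Σsteps (λ t → f (t ∷ w ∷ʳ s)))) n
      ≡⟨ total-cong (λ w → Σsteps-comm (λ s t → f (t ∷ w ∷ʳ s))) n ⟩
    total (λ w → Σsteps (λ t → Σsteps (λ s → f (t ∷ w ∷ʳ s)))) n
      ≡⟨ total-by-first _ n ⟨
    total (λ w → Σsteps (λ s → f (w ∷ʳ s))) (suc n)
      ∎

  ending : Step → ℕ → ℕ → ℕ
  ending l n j = total (at j l ∘ run start) n

  ending-suc : ∀ l n j → ending l (suc n) j ≡ total (λ w → Σsteps (λ t → at j l (step (run start w) t))) n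
  ending-suc l n j = trans (total-by-last _ n) (total-cong (λ w → Σsteps-cong (λ t → cong (at j l) (foldl-∷ʳ step start t w))) n)

  ending-U-zero : ∀ n → ending U (suc n) 0 ≡ 0
  ending-U-zero n = trans (ending-suc U n 0) (trans (total-cong (inflow-U-zero ∘ run start) n) (total-zero n))

  ending-U-suc : ∀ n j → ending U (suc n) (suc j) ≡ ending U n j + ending H n j + ending D n j
  ending-U-suc n j = begin
    ending U (suc n) (suc j)
      ≡⟨ ending-suc U n (suc j) ⟩
    total (λ w → Σsteps (λ t → at (suc j) U (step (run start w) t))) n
      ≡⟨ total-cong (inflow-U-suc j ∘ run start) n ⟩
    total (λ w → at j U (run start w) + at j H (run start w) + at j D (run start w)) n
      ≡⟨ total-+ _ _ n ⟩
    total (λ w → at j U (run start w) + at j H (run start w)) n + ending D n j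
      ≡⟨ cong (_+ ending D n j) (total-+ _ _ n) ⟩
    ending U n j + ending H n j + ending D n j
      ∎

  ending-H : ∀ n j → ending H (suc n) j ≡ ending U n j + ending D n j
  ending-H n j = trans (ending-suc H n j) (trans (total-cong (inflow-H j ∘ run start) n) (total-+ _ _ n))

  ending-D : ∀ n j → ending D (suc n) j ≡ ending U n (suc j) + ending H n (suc j)
  ending-D n j = trans (ending-suc D n j) (trans (total-cong (inflow-D j ∘ run start) n) (total-+ _ _ n))

  count-as-total : ∀ {A : Set} (p : A → Bool) xs → count p xs ≡ sum (map (indicator ∘ p) xs)
  count-as-total p [] = refl
  count-as-total p (x ∷ xs) with p x
  ... | true  = cong suc (count-as-total p xs)
  ... | false = count-as-total p xs

  indicator-endsAt : ∀ j s → indicator (endsAt j s) ≡ at j U s + at j H s + at j D s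
  indicator-endsAt j dead        = refl
  indicator-endsAt j (alive h U) = sym (trans (+-identityʳ _) (+-identityʳ _))
  indicator-endsAt j (alive h H) = sym (+-identityʳ _)
  indicator-endsAt j (alive h D) = refl

  m≡Σending : ∀ n j → m n j ≡ ending U n j + ending H n j + ending D n j
  m≡Σending n j = begin
    m n j
      ≡⟨ count-as-total _ (words n) ⟩
    total (λ w → indicator (inM w ∧ eqℤ (level w) (+ j))) n
      ≡⟨ total-cong (λ w → trans (cong indicator (inM-endsAt j w)) (indicator-endsAt j (run start w))) n ⟩
    total (λ w → at j U (run start w) + at j H (run start w) + at j D (run start w)) n
      ≡⟨ total-+ _ _ n ⟩
    total (λ w → at j U (run start w) + at j H (run start w)) n + ending D n j
      ≡⟨ cong (_+ ending D n j) (total-+ _ _ n) ⟩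
    ending U n j + ending H n j + ending D n j
      ∎

open Counting

module ClosedForms (ρ : FPS) (ρ-fixed : ρ ≈ oneₛ ⊕ zₛ ⊛ zₛ ⊛ (oneₛ ⊕ zₛ) ⊛ ρ ⊛ (oneₛ ⊕ zₛ ⊛ ρ)) where
  open Solver using (solve; con; _:+_; _:*_; _:-_; _:=_)

  x : FPS
  x = zₛ ⊛ ((oneₛ ⊕ zₛ) ⊛ ρ)

  -- Geometric in j; the fixed-point equation of ρ is exactly what the recurrence for the
  -- last letter D requires.
  endingGF : Step → ℕ → FPS
  endingGF U j = x ^ₛ j
  endingGF H j = zₛ ⊛ ρ ⊛ x ^ₛ j
  endingGF D j = (ρ ⊖ oneₛ) ⊛ x ^ₛ j

  endingGF-U-suc : ∀ j → endingGF U (suc j) ≈ zₛ ⊛ (endingGF U j ⊕ endingGF H j ⊕ endingGF D j)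
  endingGF-U-suc j = solve 3 (λ z ρ X → z :* ((con (+ 1) :+ z) :* ρ) :* X
                                := z :* (X :+ z :* ρ :* X :+ (ρ :- con (+ 1)) :* X)) ≈-refl zₛ ρ (x ^ₛ j)

  endingGF-H : ∀ j → endingGF H j ≈ zₛ ⊛ (endingGF U j ⊕ endingGF D j)
  endingGF-H j = solve 3 (λ z ρ X → z :* ρ :* X := z :* (X :+ (ρ :- con (+ 1)) :* X)) ≈-refl zₛ ρ (x ^ₛ j)

  endingGF-D : ∀ j → endingGF D j ≈ zₛ ⊛ (endingGF U (suc j) ⊕ endingGF H (suc j))
  endingGF-D j = begin
    (ρ ⊖ oneₛ) ⊛ x ^ₛ j
      ≈⟨ ⊛-congʳ (x ^ₛ j) (⊖-cong ρ-fixed (≈-refl {oneₛ})) ⟩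
    (oneₛ ⊕ zₛ ⊛ zₛ ⊛ (oneₛ ⊕ zₛ) ⊛ ρ ⊛ (oneₛ ⊕ zₛ ⊛ ρ) ⊖ oneₛ) ⊛ x ^ₛ j
      ≈⟨ solve 3 (λ z ρ X → (con (+ 1) :+ z :* z :* (con (+ 1) :+ z) :* ρ :* (con (+ 1) :+ z :* ρ) :- con (+ 1)) :* X
                   := z :* (z :* ((con (+ 1) :+ z) :* ρ) :* X :+ z :* ρ :* (z :* ((con (+ 1) :+ z) :* ρ) :* X))) ≈-refl zₛ ρ (x ^ₛ j) ⟩
    zₛ ⊛ (endingGF U (suc j) ⊕ endingGF H (suc j))
      ∎
    where open ≈-Reasoning

  ending≡endingGF : ∀ l n j → + ending l n j ≡ endingGF l j n
  ending≡endingGF U zero    zero    = refl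
  ending≡endingGF U zero    (suc j) = sym (zₛ⊛-factor-zero (endingGF U j ⊕ endingGF H j ⊕ endingGF D j) (endingGF-U-suc j))
  ending≡endingGF H zero    j       = sym (zₛ⊛-factor-zero (endingGF U j ⊕ endingGF D j) (endingGF-H j))
  ending≡endingGF D zero    j       = sym (zₛ⊛-factor-zero (endingGF U (suc j) ⊕ endingGF H (suc j)) (endingGF-D j))
  ending≡endingGF U (suc n) zero    = cong +_ (ending-U-zero n)
  ending≡endingGF U (suc n) (suc j) = begin
    + ending U (suc n) (suc j)
      ≡⟨ cong +_ (ending-U-suc n j) ⟩
    + ending U n j ℤ.+ + ending H n j ℤ.+ + ending D n j
      ≡⟨ cong₂ ℤ._+_ (cong₂ ℤ._+_ (ending≡endingGF U n j) (ending≡endingGF H n j)) (ending≡endingGF D n j) ⟩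
    (endingGF U j ⊕ endingGF H j ⊕ endingGF D j) n
      ≡⟨ zₛ⊛-factor-suc (endingGF U j ⊕ endingGF H j ⊕ endingGF D j) (endingGF-U-suc j) n ⟨
    endingGF U (suc j) (suc n)
      ∎
    where open ≡-Reasoning
  ending≡endingGF H (suc n) j = begin
    + ending H (suc n) j
      ≡⟨ cong +_ (ending-H n j) ⟩
    + ending U n j ℤ.+ + ending D n j
      ≡⟨ cong₂ ℤ._+_ (ending≡endingGF U n j) (ending≡endingGF D n j) ⟩
    (endingGF U j ⊕ endingGF D j) n
      ≡⟨ zₛ⊛-factor-suc (endingGF U j ⊕ endingGF D j) (endingGF-H j) n ⟨
    endingGF H j (suc n)
      ∎
    where open ≡-Reasoning
  ending≡endingGF D (suc n) j = begin
    + ending D (suc n) j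
      ≡⟨ cong +_ (ending-D n j) ⟩
    + ending U n (suc j) ℤ.+ + ending H n (suc j)
      ≡⟨ cong₂ ℤ._+_ (ending≡endingGF U n (suc j)) (ending≡endingGF H n (suc j)) ⟩
    (endingGF U (suc j) ⊕ endingGF H (suc j)) n
      ≡⟨ zₛ⊛-factor-suc (endingGF U (suc j) ⊕ endingGF H (suc j)) (endingGF-D j) n ⟨
    endingGF D j (suc n)
      ∎
    where open ≡-Reasoning

  Sj≈Σ-endingGF : ∀ j → Sj j ≈ endingGF U j ⊕ endingGF H j ⊕ endingGF D j
  Sj≈Σ-endingGF j n = trans (cong +_ (m≡Σending n j))
    (cong₂ ℤ._+_ (cong₂ ℤ._+_ (ending≡endingGF U n j) (ending≡endingGF H n j)) (ending≡endingGF D n j))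

  Sj-closed-form : ∀ j → Sj j ≈ (oneₛ ⊕ zₛ) ⊛ ρ ⊛ x ^ₛ j
  Sj-closed-form j = ≈-trans (Sj≈Σ-endingGF j)
    (solve 3 (λ z ρ X → X :+ z :* ρ :* X :+ (ρ :- con (+ 1)) :* X := (con (+ 1) :+ z) :* ρ :* X) ≈-refl zₛ ρ (x ^ₛ j))

module BivariateColumns where
  open import Data.Nat using (_∸_)
  open import Data.Integer using (_+_; _*_)
  open ≡-Reasoning

  column : BPS → ℕ → FPS
  column F j n = F n j

  LinearInU : BPS → Set
  LinearInU Q = ∀ n k → Q n (suc (suc k)) ≡ + 0

  last-two-terms : ∀ (q : ℕ → ℤ) → (∀ k → q (suc (suc k)) ≡ + 0) →
                   ∀ (p : ℕ → ℤ) j → sumℤ (map (λ b → p b * q (suc j ∸ b)) (upTo (suc (suc j)))) ≡ p j * q 1 + p (suc j) * q 0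
  last-two-terms q q-vanishes p j = trans (cong sumℤ (map-upTo (λ b → p b * q (suc j ∸ b)) (suc (suc j)))) (go p j)
    where
    go : ∀ p j → sumℤ (applyUpTo (λ b → p b * q (suc j ∸ b)) (suc (suc j))) ≡ p j * q 1 + p (suc j) * q 0
    go p zero = cong (_+_ (p 0 * q 1)) (ℤP.+-identityʳ (p 1 * q 0))
    go p (suc j) = begin
      p 0 * q (suc (suc j)) + sumℤ (applyUpTo (λ b → p (suc b) * q (suc j ∸ b)) (suc (suc j)))
        ≡⟨ cong₂ _+_ (trans (cong (p 0 *_) (q-vanishes j)) (ℤP.*-zeroʳ (p 0))) (go (p ∘ suc) j) ⟩
      + 0 + (p (suc j) * q 1 + p (suc (suc j)) * q 0)
        ≡⟨ ℤP.+-identityˡ _ ⟩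
      p (suc j) * q 1 + p (suc (suc j)) * q 0
        ∎

  ⊛₂-column-zero : ∀ P Q → column (P ⊛₂ Q) 0 ≈ column P 0 ⊛ column Q 0
  ⊛₂-column-zero P Q n = cong sumℤ (map-cong (λ a → ℤP.+-identityʳ (P a 0 * Q (n ∸ a) 0)) (upTo (suc n)))

  ⊛₂-column-suc : ∀ P Q → LinearInU Q → ∀ j →
                  column (P ⊛₂ Q) (suc j) ≈ column P j ⊛ column Q 1 ⊕ column P (suc j) ⊛ column Q 0
  ⊛₂-column-suc P Q Q-linear j n = begin
    (P ⊛₂ Q) n (suc j)
      ≡⟨ cong sumℤ (map-cong (λ a → last-two-terms (Q (n ∸ a)) (Q-linear (n ∸ a)) (P a) j) (upTo (suc n))) ⟩
    sumℤ (map (λ a → P a j * Q (n ∸ a) 1 + P a (suc j) * Q (n ∸ a) 0) (upTo (suc n)))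
      ≡⟨ sum-map-∙ ℤP.+-0-commutativeMonoid (λ a → P a j * Q (n ∸ a) 1) (λ a → P a (suc j) * Q (n ∸ a) 0) (upTo (suc n)) ⟩
    (column P j ⊛ column Q 1) n + (column P (suc j) ⊛ column Q 0) n
      ∎

  column-uₛ-0 : column uₛ 0 ≈ zeroₛ
  column-uₛ-0 zero    = refl
  column-uₛ-0 (suc n) = refl

  column-uₛ-1 : column uₛ 1 ≈ oneₛ
  column-uₛ-1 zero    = refl
  column-uₛ-1 (suc n) = refl

  column-uₛ-2+ : ∀ k → column uₛ (suc (suc k)) ≈ zeroₛ
  column-uₛ-2+ k zero    = refl
  column-uₛ-2+ k (suc n) = refl

  u-affine : FPS → FPS → BPS
  u-affine f g = liftz f ⊖₂ uₛ ⊛₂ liftz g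

  u·liftz-column-0 : ∀ g → column (uₛ ⊛₂ liftz g) 0 ≈ zeroₛ
  u·liftz-column-0 g n = trans (⊛₂-column-zero uₛ (liftz g) n) (⊛-zeroˡ g column-uₛ-0 n)

  u·liftz-column-suc : ∀ g j → column (uₛ ⊛₂ liftz g) (suc j) ≈ column uₛ (suc j) ⊛ g
  u·liftz-column-suc g j n = begin
    (uₛ ⊛₂ liftz g) n (suc j)
      ≡⟨ ⊛₂-column-suc uₛ (liftz g) (λ _ _ → refl) j n ⟩
    (column uₛ j ⊛ column (liftz g) 1) n + (column uₛ (suc j) ⊛ g) n
      ≡⟨ cong (_+ (column uₛ (suc j) ⊛ g) n) (⊛-zeroʳ (column uₛ j) (λ _ → refl) n) ⟩
    + 0 + (column uₛ (suc j) ⊛ g) n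
      ≡⟨ ℤP.+-identityˡ _ ⟩
    (column uₛ (suc j) ⊛ g) n
      ∎

  u-affine-column-0 : ∀ f g → column (u-affine f g) 0 ≈ f
  u-affine-column-0 f g n = trans (cong (λ a → f n ℤ.- a) (u·liftz-column-0 g n)) (ℤP.+-identityʳ (f n))

  u-affine-column-1 : ∀ f g → column (u-affine f g) 1 ≈ negₛ g
  u-affine-column-1 f g n = begin
    + 0 ℤ.- (uₛ ⊛₂ liftz g) n 1
      ≡⟨ cong (λ a → + 0 ℤ.- a) (trans (u·liftz-column-suc g 0 n) (trans (⊛-congʳ g column-uₛ-1 n) (⊛-identityˡ g n))) ⟩
    + 0 ℤ.- g n
      ≡⟨ ℤP.+-identityˡ _ ⟩
    - g n
      ∎

  u-affine-linear : ∀ f g → LinearInU (u-affine f g)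
  u-affine-linear f g n k = cong (λ a → + 0 ℤ.- a) (trans (u·liftz-column-suc g (suc k) n) (⊛-zeroˡ g (column-uₛ-2+ k) n))

  liftz⊛₂-column-1 : ∀ h Q → LinearInU Q → column (liftz h ⊛₂ Q) 1 ≈ h ⊛ column Q 1
  liftz⊛₂-column-1 h Q Q-linear n = begin
    (liftz h ⊛₂ Q) n 1
      ≡⟨ ⊛₂-column-suc (liftz h) Q Q-linear 0 n ⟩
    (h ⊛ column Q 1) n + (zeroₛ ⊛ column Q 0) n
      ≡⟨ cong (_+_ ((h ⊛ column Q 1) n)) (⊛-zeroˡ (column Q 0) (λ _ → refl) n) ⟩
    (h ⊛ column Q 1) n + + 0
      ≡⟨ ℤP.+-identityʳ _ ⟩
    (h ⊛ column Q 1) n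
      ∎

  liftz⊛₂-linear : ∀ h Q → LinearInU Q → LinearInU (liftz h ⊛₂ Q)
  liftz⊛₂-linear h Q Q-linear n k =
    trans (⊛₂-column-suc (liftz h) Q Q-linear (suc k) n)
          (cong₂ _+_ (⊛-zeroˡ (column Q 1) (λ _ → refl) n) (⊛-zeroˡ (column Q 0) (λ _ → refl) n))

open BivariateColumns

open import Data.Nat using (_+_)

module Conclusion {r : FPS} (factorisation : Factorisation r) where
  open Factorisation factorisation
  open ClosedForms ρ ρ-fixed
  open Solver using (solve; con; _:+_; _:*_; _:-_; :-_; _:=_)
  open ≈-Reasoning

  F : FPS
  F = onePlusZ ⊛ r

  F≈ : F ≈ (oneₛ ⊕ zₛ) ⊛ (zₛ ⊛ (zₛ ⊛ ρ))
  F≈ = ⊛-cong onePlusZ≈ r≈z²ρ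

  Y : BPS
  Y = liftz zₛ ⊛₂ u-affine zₛ F

  Y-linear : LinearInU Y
  Y-linear = liftz⊛₂-linear zₛ (u-affine zₛ F) (u-affine-linear zₛ F)

  Y-column-0 : column Y 0 ≈ zₛ ⊛ zₛ
  Y-column-0 = ≈-trans (⊛₂-column-zero (liftz zₛ) (u-affine zₛ F)) (⊛-congˡ zₛ (u-affine-column-0 zₛ F))

  Y-column-1 : column Y 1 ≈ zₛ ⊛ negₛ F
  Y-column-1 = ≈-trans (liftz⊛₂-column-1 zₛ (u-affine zₛ F) (u-affine-linear zₛ F)) (⊛-congˡ zₛ (u-affine-column-1 zₛ F))

  power-form : ∀ j →
               zₛ ^ₛ (j + 2) ⊛ ((oneₛ ⊕ zₛ) ⊛ ρ ⊛ x ^ₛ j) ≈ (oneₛ ⊕ zₛ) ^ₛ suc j ⊛ (zₛ ⊛ (zₛ ⊛ ρ)) ^ₛ suc j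
  power-form zero = solve 2 (λ z ρ → z :* (z :* con (+ 1)) :* ((con (+ 1) :+ z) :* ρ :* con (+ 1))
                                 := (con (+ 1) :+ z) :* con (+ 1) :* (z :* (z :* ρ) :* con (+ 1))) ≈-refl zₛ ρ
  power-form (suc j) = begin
    zₛ ⊛ zₛ ^ₛ (j + 2) ⊛ ((oneₛ ⊕ zₛ) ⊛ ρ ⊛ (x ⊛ x ^ₛ j))
      ≈⟨ solve 4 (λ z ρ Z X → z :* Z :* ((con (+ 1) :+ z) :* ρ :* (z :* ((con (+ 1) :+ z) :* ρ) :* X))
                      := z :* (z :* ((con (+ 1) :+ z) :* ρ)) :* (Z :* ((con (+ 1) :+ z) :* ρ :* X)))
                  ≈-refl zₛ ρ (zₛ ^ₛ (j + 2)) (x ^ₛ j) ⟩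
    zₛ ⊛ x ⊛ (zₛ ^ₛ (j + 2) ⊛ ((oneₛ ⊕ zₛ) ⊛ ρ ⊛ x ^ₛ j))
      ≈⟨ ⊛-congˡ (zₛ ⊛ x) (power-form j) ⟩
    zₛ ⊛ x ⊛ ((oneₛ ⊕ zₛ) ^ₛ suc j ⊛ (zₛ ⊛ (zₛ ⊛ ρ)) ^ₛ suc j)
      ≈⟨ solve 4 (λ z ρ A R → z :* (z :* ((con (+ 1) :+ z) :* ρ)) :* (A :* R)
                      := (con (+ 1) :+ z) :* A :* (z :* (z :* ρ) :* R))
                  ≈-refl zₛ ρ ((oneₛ ⊕ zₛ) ^ₛ suc j) ((zₛ ⊛ (zₛ ⊛ ρ)) ^ₛ suc j) ⟩
    (oneₛ ⊕ zₛ) ^ₛ suc (suc j) ⊛ (zₛ ⊛ (zₛ ⊛ ρ)) ^ₛ suc (suc j)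
      ∎

  Sj-power-form : ∀ j → zₛ ^ₛ (j + 2) ⊛ Sj j ≈ onePlusZ ^ₛ suc j ⊛ r ^ₛ suc j
  Sj-power-form j = begin
    zₛ ^ₛ (j + 2) ⊛ Sj j
      ≈⟨ ⊛-congˡ (zₛ ^ₛ (j + 2)) (Sj-closed-form j) ⟩
    zₛ ^ₛ (j + 2) ⊛ ((oneₛ ⊕ zₛ) ⊛ ρ ⊛ x ^ₛ j)
      ≈⟨ power-form j ⟩
    (oneₛ ⊕ zₛ) ^ₛ suc j ⊛ (zₛ ⊛ (zₛ ⊛ ρ)) ^ₛ suc j
      ≈⟨ ⊛-cong (^ₛ-cong (suc j) onePlusZ≈) (^ₛ-cong (suc j) r≈z²ρ) ⟨
    onePlusZ ^ₛ suc j ⊛ r ^ₛ suc j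
      ∎

  S-functional-equation : S ⊛₂ (liftz zₛ ⊛₂ u-affine zₛ (onePlusZ ⊛ r)) ≈₂ liftz (onePlusZ ⊛ r)
  S-functional-equation n zero    = column-0 n
    where
    column-0 : column (S ⊛₂ Y) 0 ≈ F
    column-0 = begin
      column (S ⊛₂ Y) 0                          ≈⟨ ⊛₂-column-zero S Y ⟩
      Sj 0 ⊛ column Y 0                          ≈⟨ ⊛-cong (Sj-closed-form 0) Y-column-0 ⟩
      (oneₛ ⊕ zₛ) ⊛ ρ ⊛ oneₛ ⊛ (zₛ ⊛ zₛ)          ≈⟨ solve 2 (λ z ρ → (con (+ 1) :+ z) :* ρ :* con (+ 1) :* (z :* z)
                                                        := (con (+ 1) :+ z) :* (z :* (z :* ρ))) ≈-refl zₛ ρ ⟩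
      (oneₛ ⊕ zₛ) ⊛ (zₛ ⊛ (zₛ ⊛ ρ))               ≈⟨ F≈ ⟨
      F                                          ∎
  S-functional-equation n (suc j) = column-suc n
    where
    column-suc : column (S ⊛₂ Y) (suc j) ≈ zeroₛ
    column-suc = begin
      column (S ⊛₂ Y) (suc j)
        ≈⟨ ⊛₂-column-suc S Y Y-linear j ⟩
      Sj j ⊛ column Y 1 ⊕ Sj (suc j) ⊛ column Y 0
        ≈⟨ +-cong (⊛-cong (Sj-closed-form j) (≈-trans Y-column-1 (⊛-congˡ zₛ (λ k → cong -_ (F≈ k)))))
                  (⊛-cong (Sj-closed-form (suc j)) Y-column-0) ⟩
      (oneₛ ⊕ zₛ) ⊛ ρ ⊛ x ^ₛ j ⊛ (zₛ ⊛ negₛ ((oneₛ ⊕ zₛ) ⊛ (zₛ ⊛ (zₛ ⊛ ρ))))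
        ⊕ (oneₛ ⊕ zₛ) ⊛ ρ ⊛ (x ⊛ x ^ₛ j) ⊛ (zₛ ⊛ zₛ)
        ≈⟨ solve 3 (λ z ρ X → (con (+ 1) :+ z) :* ρ :* X :* (z :* (:- ((con (+ 1) :+ z) :* (z :* (z :* ρ)))))
                                :+ (con (+ 1) :+ z) :* ρ :* (z :* ((con (+ 1) :+ z) :* ρ) :* X) :* (z :* z)
                              := con (+ 0)) ≈-refl zₛ ρ (x ^ₛ j) ⟩
      const (+ 0)
        ≈⟨ (λ { zero → refl ; (suc k) → refl }) ⟩
      zeroₛ
        ∎

open Conclusion

mainTheorem7 : (W r₁ : FPS)
    → W 0 ≡ + 1
    → W ⊛ W ≈ radicand
    → denPoly ⊛ r₁ ≈ numPoly ⊖ W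
    → (S ⊛₂ (liftz zₛ ⊛₂ (liftz zₛ ⊖₂ uₛ ⊛₂ liftz (onePlusZ ⊛ r₁))) ≈₂ liftz (onePlusZ ⊛ r₁))
    × (∀ (j : ℕ) → zₛ ^ₛ (j + 2) ⊛ Sj j ≈ (onePlusZ ^ₛ suc j) ⊛ (r₁ ^ₛ suc j))
mainTheorem7 W r₁ _ W²≈radicand den·r₁≈num-W = S-functional-equation factorisation , Sj-power-form factorisation
  where
  factorisation : Factorisation r₁
  factorisation = factorise (kernel-fixpoint W²≈radicand den·r₁≈num-W)
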